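{- There is no finite set $\mathsf{X}$ of syllogistic rules in the language $\mathcal{H}$ such that the direct syllogistic derivation relation $\vdash_{\mathsf{X}}$ is both sound and complete for $\mathcal{H}$.
   Context: Fix a countably infinite set $\mathbf{P}$ of atoms. A literal is an expression $p$ or $\bar p$ with $p$ an atom. A structure $\mathfrak{A}$ consists of a non-empty set $A$ (its domain) together with a subset $p^{\mathfrak A}\subseteq A$ for every atom $p$; put $\bar p^{\mathfrak A}=A\setminus p^{\mathfrak A}$. A c-term is a literal or an expression $\forall p$ or $\overline{\forall p}$ with $p$ an atom. The bar operation on c-terms is the involution with $\bar{\bar p}=p$ and $\overline{\overline{\forall p}}=\forall p$. Set $(\forall \ell)^{\mathfrak A}=\{a\in A : a=b \text{ for all } b\in \ell^{\mathfrak A}\}$ and $(\overline{\forall\ell})^{\mathfrak A}=A\setminus(\forall\ell)^{\mathfrak A}$. An $\mathcal{H}$-formula is an expression of one of the forms $\forall(p,c)$, $\forall(c,\bar p)$, $\exists(p,c)$, $\exists(c,p)$, where $p$ is an atom and $c$ a c-term. $\mathfrak A\models\forall(e,f)$ iff $e^{\mathfrak A}\subseteq f^{\mathfrak A}$, and $\mathfrak A\models\exists(e,f)$ iff $e^{\mathfrak A}\cap f^{\mathfrak A}\neq\emptyset$. The formulas $\exists(e,f)$ and $\exists(f,e)$ are identified, as are $\forall(e,f)$ and $\forall(\bar f,\bar e)$. A set $\Theta$ entails $\theta$ ($\Theta\models\theta$) if every structure satisfying all of $\Theta$ satisfies $\theta$. An absurdity is a formula $\exists(e,\bar e)$. A syllogistic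 rule in $\mathcal H$ is a pair $\Theta/\theta$ with $\Theta$ a finite (possibly empty) set of $\mathcal H$-formulas and $\theta$ an $\mathcal H$-formula. A substitution is a map $g:\mathbf P\to\mathbf P$, extended to formulas and sets of formulas by replacing atoms. For a set $\mathsf X$ of rules, $\vdash_{\mathsf X}$ is the smallest relation between sets of $\mathcal H$-formulas and $\mathcal H$-formulas such that: (1) if $\theta\in\Theta$ then $\Theta\vdash_{\mathsf X}\theta$; (2) if $\{\theta_1,\dots,\theta_n\}/\theta\in\mathsf X$, $g$ is a substitution, $\Theta=\Theta_1\cup\dots\cup\Theta_n$ and $\Theta_i\vdash_{\mathsf X} g(\theta_i)$ for all $i$, then $\Theta\vdash_{\mathsf X} g(\theta)$. $\vdash_{\mathsf X}$ is sound if $\Theta\vdash_{\mathsf X}\theta$ implies $\Theta\models\theta$, and complete if $\Theta\models\theta$ implies $\Theta\vdash_{\mathsf X}\theta$. -}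

module Defs where

open import Level using (0ℓ)
open import Data.Nat using (ℕ)
open import Data.Fin using (Fin)
open import Data.List using (List; length; lookup)
open import Data.List.Relation.Unary.All using (All)
open import Data.List.Membership.Propositional using (_∈_)
open import Data.Product using (Σ; _×_; _,_)
open import Data.Sum using (_⊎_)
open import Data.Empty using (⊥)
open import Relation.Nullary using (¬_)
open import Relation.Binary.PropositionalEquality using (_≡_)
open import Axiom.ExcludedMiddle using (ExcludedMiddle)

Atom : Set
Atom = ℕ

-- c-terms: p, p̄, ∀p, (∀p)‾   (literals are the first two forms)
data CTerm : Set where
  pos  : Atom → CTerm
  neg  : Atom → CTerm
  uall : Atom → CTerm
  nall : Atom → CTerm

bar : CTerm → CTerm
bar (pos p)  = neg p
bar (neg p)  = pos p
bar (uall p) = nall p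
bar (nall p) = uall p

data Formula : Set where
  univ : CTerm → CTerm → Formula
  exis : CTerm → CTerm → Formula

data IsH : Formula → Set where
  univ-pc : ∀ p c → IsH (univ (pos p) c)
  univ-cp : ∀ c p → IsH (univ c (neg p))
  exis-pc : ∀ p c → IsH (exis (pos p) c)
  exis-cp : ∀ c p → IsH (exis c (pos p))

-- identification: ∃(e,f) = ∃(f,e), ∀(e,f) = ∀(f̄,ē)
swap : Formula → Formula
swap (univ e f) = univ (bar f) (bar e)
swap (exis e f) = exis f e

_≈_ : Formula → Formula → Set
φ ≈ ψ = (φ ≡ ψ) ⊎ (φ ≡ swap ψ)

record Structure : Set₁ where
  field
    Dom  : Set
    elt  : Dom                 -- the domain is non-empty
    val  : Atom → Dom → Set

module _ (M : Structure) where
  open Structure M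

  ⟦_⟧ : CTerm → Dom → Set
  ⟦ pos p ⟧  a = val p a
  ⟦ neg p ⟧  a = ¬ val p a
  ⟦ uall p ⟧ a = ∀ b → val p b → a ≡ b
  ⟦ nall p ⟧ a = ¬ (∀ b → val p b → a ≡ b)

  Sat : Formula → Set
  Sat (univ e f) = ∀ a → ⟦ e ⟧ a → ⟦ f ⟧ a
  Sat (exis e f) = Σ Dom λ a → ⟦ e ⟧ a × ⟦ f ⟧ a

FSet : Set₁
FSet = Formula → Set

_⊨_ : FSet → Formula → Set₁
Θ ⊨ θ = (M : Structure) → (∀ φ → Θ φ → Sat M φ) → Sat M θ

record Rule : Set where
  field
    prem   : List Formula
    concl  : Formula
    premH  : All IsH prem
    conclH : IsH concl
open Rule public

substC : (Atom → Atom) → CTerm → CTerm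
substC g (pos p)  = pos (g p)
substC g (neg p)  = neg (g p)
substC g (uall p) = uall (g p)
substC g (nall p) = nall (g p)

substF : (Atom → Atom) → Formula → Formula
substF g (univ e f) = univ (substC g e) (substC g f)
substF g (exis e f) = exis (substC g e) (substC g f)

_∈ₛ_ : Formula → FSet → Set
φ ∈ₛ Θ = Σ Formula λ ψ → Θ ψ × (φ ≈ ψ)

-- Θ = Θ₁ ∪ ... ∪ Θₙ (as sets of formulas up to identification)
_≐⋃_ : FSet → ∀ {n} → (Fin n → FSet) → Set
_≐⋃_ Θ {n} Θs = ∀ φ → ((φ ∈ₛ Θ) → Σ (Fin n) λ i → φ ∈ₛ Θs i)
                     × ((Σ (Fin n) λ i → φ ∈ₛ Θs i) → φ ∈ₛ Θ)

data _⊢[_]_ (X : List Rule) : FSet → Formula → Set₁ where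
  hyp : ∀ {Θ θ} → θ ∈ₛ Θ → X ⊢[ Θ ] θ
  app : ∀ {Θ θ} (r : Rule) → r ∈ X → (g : Atom → Atom)
        → (Θs : Fin (length (prem r)) → FSet)
        → (∀ i → X ⊢[ Θs i ] substF g (lookup (prem r) i))
        → Θ ≐⋃ Θs
        → θ ≈ substF g (concl r)
        → X ⊢[ Θ ] θ

AllH : FSet → Set
AllH Θ = ∀ φ → Θ φ → IsH φ

Sound : List Rule → Set₁
Sound X = ∀ Θ θ → AllH Θ → IsH θ → X ⊢[ Θ ] θ → Θ ⊨ θ

Complete : List Rule → Set₁
Complete X = ∀ Θ θ → AllH Θ → IsH θ → Θ ⊨ θ → X ⊢[ Θ ] θ

module Submission where

-- Let X be finite and sound, let every rule of X have at most w premises and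
-- put n = 2w + 1.  The set Θ n, consisting of
--   ∀(p₀, ‾∀p_{i+1}) (i ≤ n),   ∀(p_{i+1}, ∀p_{i+2}) (i < n),   ∀(p₁, ‾p_{n+1}),
-- entails ∀(p₀, p̄₀): a point of p₀ makes every p_{i+1} non-empty, the links
-- glue all of them to one point, and the last formula separates p₁ from
-- p_{n+1}.  For k < n the three-point structure N k (p₀ = {base},
-- p_{i+1} = {left} for i ≤ k and {right} otherwise) satisfies all of Θ n except
-- the k-th link, and refutes ∀(p₀, p̄₀).
--
-- Every formula ψ derivable from Θ n is therefore "invariant": Θ n ⊨ ψ, and
-- N k ⊨ ψ whenever ψ does not mention p_{k+1}.  For a rule instance, a counting
-- argument yields k < n with p_{k+1} absent from the at most 2w premise atoms, so
-- N k satisfies the premises and, X being sound, the conclusion; a transfer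
-- lemma carries this truth to every other admissible N k'.  As ∀(p₀, p̄₀) is
-- false in N 0, it is not derivable, so X is not complete.

open import Defs
open import Level using (0ℓ)
open import Data.Nat using (ℕ; zero; suc; _+_; _<_; _≤_; _≤?_; z≤n; s≤s)
import Data.Nat.Properties as ℕP
open import Data.Bool using (Bool; true; false)
open import Data.Fin using (Fin; toℕ; splitAt; _↑ˡ_; _↑ʳ_)
import Data.Fin.Properties as FinP
open import Data.List using (List; length; lookup; map)
open import Data.List.Extrema.Nat using (max; xs≤max)
import Data.List.Relation.Unary.All as All
open import Data.List.Membership.Propositional using (_∈_)
open import Data.List.Membership.Propositional.Properties using (∈-lookup; ∈-map⁺)
open import Data.Product using (Σ; _×_; _,_; proj₁; proj₂)
open import Data.Sum using (_⊎_; inj₁; inj₂; [_,_])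
open import Data.Empty using (⊥-elim)
open import Function using (_∘_; id)
open import Function.Bundles using (_⇔_; mk⇔; module Equivalence)
open import Function.Definitions using (Injective)
open import Function.Properties.Equivalence using () renaming (refl to ⇔-refl; sym to ⇔-sym)
open import Function.Related.TypeIsomorphisms using (¬-cong-⇔)
open import Relation.Nullary using (¬_; yes; no; ¬?; does; contradiction)
open import Relation.Nullary.Decidable using (decidable-stable; dec-true; dec-false)
open import Relation.Binary.PropositionalEquality hiding ([_])
open import Axiom.ExcludedMiddle using (ExcludedMiddle)

open Equivalence using (to; from)

atomC : CTerm → Atom
atomC (pos p)  = p
atomC (neg p)  = p
atomC (uall p) = p
atomC (nall p) = p

atomL atomR : Formula → Atom
atomL (univ e f) = atomC e
atomL (exis e f) = atomC e
atomR (univ e f) = atomC f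
atomR (exis e f) = atomC f

atomC-bar : ∀ c → atomC (bar c) ≡ atomC c
atomC-bar (pos p)  = refl
atomC-bar (neg p)  = refl
atomC-bar (uall p) = refl
atomC-bar (nall p) = refl

-- The identity substitution; used to apply a rule to its own premises.
substC-id : ∀ c → substC id c ≡ c
substC-id (pos p)  = refl
substC-id (neg p)  = refl
substC-id (uall p) = refl
substC-id (nall p) = refl

substF-id : ∀ φ → substF id φ ≡ φ
substF-id (univ e f) = cong₂ univ (substC-id e) (substC-id f)
substF-id (exis e f) = cong₂ exis (substC-id e) (substC-id f)

Avoids : ℕ → Formula → Set
Avoids k φ = atomL φ ≢ suc k × atomR φ ≢ suc k

avoids-≈ : ∀ {k φ ψ} → φ ≈ ψ → Avoids k φ → Avoids k ψ
avoids-≈ (inj₁ refl) avoid = avoid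
avoids-≈ {k} {ψ = univ e f} (inj₂ refl) (avoid-f̄ , avoid-ē) =
  subst (_≢ suc k) (atomC-bar e) avoid-ē , subst (_≢ suc k) (atomC-bar f) avoid-f̄
avoids-≈ {ψ = exis e f} (inj₂ refl) (avoid-f , avoid-e) = avoid-e , avoid-f

module OnCarrier {D : Set} (d₀ : D) where

  Valuation : Set₁
  Valuation = Atom → D → Set

  ⟪_⟫ : Valuation → Structure
  ⟪ v ⟫ = record { Dom = D ; elt = d₀ ; val = v }

  Matches : (D → D) → Valuation → Valuation → Atom → Set
  Matches ρ v w p = ∀ x → v p (ρ x) ⇔ w p x

  module _ {ρ : D → D} (ρρ : ∀ x → ρ (ρ x) ≡ x) where

    ρ-injective : ∀ {x y} → ρ x ≡ ρ y → x ≡ y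
    ρ-injective {x} {y} eq = trans (sym (ρρ x)) (trans (cong ρ eq) (ρρ y))

    ρ-shift : ∀ {x y} → (ρ x ≡ y) ⇔ (x ≡ ρ y)
    ρ-shift {x} {y} = mk⇔ (λ eq → trans (sym (ρρ x)) (cong ρ eq)) (λ eq → trans (cong ρ eq) (ρρ y))

    module _ {v w : Valuation} where

      singleton-transport : ∀ p → Matches ρ v w p → ∀ a →
        (∀ b → w p b → a ≡ b) ⇔ (∀ b → v p b → ρ a ≡ b)
      singleton-transport p m a = mk⇔
        (λ u b b∈v → trans (cong ρ (u (ρ b) (to (m (ρ b)) (subst (v p) (sym (ρρ b)) b∈v)))) (ρρ b))
        (λ u b b∈w → ρ-injective (u (ρ b) (from (m b) b∈w)))

      term-transport : ∀ c → Matches ρ v w (atomC c) → ∀ a → ⟦_⟧ ⟪ w ⟫ c a ⇔ ⟦_⟧ ⟪ v ⟫ c (ρ a)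
      term-transport (pos p)  m a = ⇔-sym (m a)
      term-transport (neg p)  m a = ¬-cong-⇔ (⇔-sym (m a))
      term-transport (uall p) m a = singleton-transport p m a
      term-transport (nall p) m a = ¬-cong-⇔ (singleton-transport p m a)

      sat-transport : ∀ φ → Matches ρ v w (atomL φ) → Matches ρ v w (atomR φ) →
                      Sat ⟪ v ⟫ φ → Sat ⟪ w ⟫ φ
      sat-transport (univ e f) mₑ m_f s a a∈e =
        from (term-transport f m_f a) (s (ρ a) (to (term-transport e mₑ a) a∈e))
      sat-transport (exis e f) mₑ m_f (a , a∈e , a∈f) =
        ρ a , from (term-transport e mₑ (ρ a)) (subst (⟦_⟧ ⟪ v ⟫ e) (sym (ρρ a)) a∈e)
            , from (term-transport f m_f (ρ a)) (subst (⟦_⟧ ⟪ v ⟫ f) (sym (ρρ a)) a∈f)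

_∘ₛ_ : Structure → (Atom → Atom) → Structure
M ∘ₛ g = record { Dom = Structure.Dom M ; elt = Structure.elt M ; val = Structure.val M ∘ g }

term-subst : ∀ M g c → ⟦_⟧ M (substC g c) ≡ ⟦_⟧ (M ∘ₛ g) c
term-subst M g (pos p)  = refl
term-subst M g (neg p)  = refl
term-subst M g (uall p) = refl
term-subst M g (nall p) = refl

sat-subst : ∀ M g φ → Sat M (substF g φ) ≡ Sat (M ∘ₛ g) φ
sat-subst M g (univ e f) = cong₂ (λ E F → ∀ a → E a → F a) (term-subst M g e) (term-subst M g f)
sat-subst M g (exis e f) = cong₂ (λ E F → Σ _ λ a → E a × F a) (term-subst M g e) (term-subst M g f)

bar-complement : ExcludedMiddle 0ℓ → ∀ M c a → ⟦_⟧ M (bar c) a ⇔ (¬ ⟦_⟧ M c a)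
bar-complement lem M (pos p)  a = ⇔-refl
bar-complement lem M (neg p)  a = mk⇔ (λ x ¬x → ¬x x) (decidable-stable lem)
bar-complement lem M (uall p) a = ⇔-refl
bar-complement lem M (nall p) a = mk⇔ (λ x ¬x → ¬x x) (decidable-stable lem)

sat-≈ : ExcludedMiddle 0ℓ → ∀ M {φ ψ} → φ ≈ ψ → Sat M ψ → Sat M φ
sat-≈ lem M (inj₁ refl) s = s
sat-≈ lem M {ψ = univ e f} (inj₂ refl) s a a∈f̄ =
  from (bar-complement lem M e a) (λ a∈e → to (bar-complement lem M f a) a∈f̄ (s a a∈e))
sat-≈ lem M {ψ = exis e f} (inj₂ refl) (a , a∈e , a∈f) = a , a∈f , a∈e

module Derivations (X : List Rule) where

  rule-valid : Sound X → ∀ {r} → r ∈ X → ∀ M g →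
               (∀ i → Sat M (substF g (lookup (prem r) i))) → Sat M (substF g (concl r))
  rule-valid sound {r} r∈X M g premises-sat =
    subst id (sym (sat-subst M g (concl r)))
      (sound premises (concl r) premises-H (conclH r) derivation (M ∘ₛ g) premises-sat′)
    where
    premise : Fin (length (prem r)) → FSet
    premise i φ = φ ≡ lookup (prem r) i

    premises : FSet
    premises φ = Σ _ λ i → premise i φ

    premises-H : AllH premises
    premises-H _ (i , refl) = All.lookup (premH r) (∈-lookup i)

    derivation : X ⊢[ premises ] concl r
    derivation = app r r∈X id premise
      (λ i → hyp (lookup (prem r) i , refl , inj₁ (substF-id _)))
      (λ φ → (λ (ψ , (i , e) , φ≈ψ) → i , ψ , e , φ≈ψ) , (λ (i , ψ , e , φ≈ψ) → ψ , (i , e) , φ≈ψ))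
      (inj₁ (sym (substF-id (concl r))))

    premises-sat′ : ∀ φ → premises φ → Sat (M ∘ₛ g) φ
    premises-sat′ _ (i , refl) = subst id (sat-subst M g _) (premises-sat i)

  derivation-induction : (P : Formula → Set₁)
    → (∀ {φ ψ} → φ ≈ ψ → P ψ → P φ)
    → (∀ {r} → r ∈ X → ∀ g → (∀ i → P (substF g (lookup (prem r) i))) → P (substF g (concl r)))
    → ∀ {Θ ψ} → (∀ φ → Θ φ → P φ) → X ⊢[ Θ ] ψ → P ψ
  derivation-induction P resp rule base (hyp (φ , φ∈Θ , ψ≈φ)) = resp ψ≈φ (base φ φ∈Θ)
  derivation-induction P resp rule base (app r r∈X g Θs sub union ψ≈) =
    resp ψ≈ (rule r∈X g λ i → derivation-induction P resp rule (base-of i) (sub i))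
    where
    base-of : ∀ i φ → Θs i φ → P φ
    base-of i φ φ∈Θᵢ with proj₂ (union φ) (i , φ , φ∈Θᵢ , inj₁ refl)
    ... | χ , χ∈Θ , φ≈χ = resp φ≈χ (base χ χ∈Θ)

missed : ∀ {L n} → L < n → (f : Fin L → ℕ) (h : Fin n → ℕ) → Injective _≡_ _≡_ h →
         Σ (Fin n) λ k → ∀ j → f j ≢ h k
missed {L} {n} L<n f h h-injective with FinP.any? (λ k → FinP.all? (λ j → ¬? (f j ℕP.≟ h k)))
... | yes found = found
... | no  none  = contradiction (FinP.injective⇒≤ cover-injective) (ℕP.<⇒≱ L<n)
  where
  hit : ∀ k → Σ (Fin L) λ j → f j ≡ h k
  hit k with FinP.¬∀⟶∃¬ L (λ j → f j ≢ h k) (λ j → ¬? (f j ℕP.≟ h k)) (λ misses → none (k , misses))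
  ... | j , ¬misses = j , decidable-stable (f j ℕP.≟ h k) ¬misses

  cover : Fin n → Fin L
  cover = proj₁ ∘ hit

  cover-injective : Injective _≡_ _≡_ cover
  cover-injective {k} {k'} eq = h-injective (trans (sym (proj₂ (hit k))) (trans (cong f eq) (proj₂ (hit k'))))

fresh-index : ∀ {L n} → L + L < n → (f g : Fin L → Atom) →
              Σ ℕ λ k → k < n × (∀ j → f j ≢ suc k × g j ≢ suc k)
fresh-index {L} lt f g with missed lt ([ f , g ] ∘ splitAt L) (suc ∘ toℕ)
                              (λ eq → FinP.toℕ-injective (ℕP.suc-injective eq))
... | k , misses = toℕ k , FinP.toℕ<n k , λ j →
  (λ e → misses (j ↑ˡ L) (trans (cong [ f , g ] (FinP.splitAt-↑ˡ L j L)) e)) ,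
  (λ e → misses (L ↑ʳ j) (trans (cong [ f , g ] (FinP.splitAt-↑ʳ L L j)) e))

data Three : Set where
  base left right : Three

open OnCarrier base

point : Bool → Three
point true  = left
point false = right

flip : Three → Three
flip base  = base
flip left  = right
flip right = left

perm : Bool → Three → Three
perm false x = x
perm true  x = flip x

flip-involutive : ∀ x → flip (flip x) ≡ x
flip-involutive base  = refl
flip-involutive left  = refl
flip-involutive right = refl

flip-shift : ∀ {x y} → (flip x ≡ y) ⇔ (x ≡ flip y)
flip-shift = ρ-shift {ρ = flip} flip-involutive

perm-involutive : ∀ b x → perm b (perm b x) ≡ x
perm-involutive false x = refl
perm-involutive true  x = flip-involutive x

Nval : ℕ → Valuation
Nval k zero    x = x ≡ base
Nval k (suc i) x = x ≡ point (does (i ≤? k))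

N : ℕ → Structure
N k = ⟪ Nval k ⟫

side-step : ∀ {i k} → i ≢ k → does (i ≤? k) ≡ does (suc i ≤? k)
side-step {i} {k} i≢k with suc i ≤? k
... | yes i<k = trans (dec-true (i ≤? k) (ℕP.<⇒≤ i<k)) (sym (dec-true (suc i ≤? k) i<k))
... | no  i≮k = trans (dec-false (i ≤? k) (λ i≤k → i≮k (ℕP.≤∧≢⇒< i≤k i≢k)))
                      (sym (dec-false (suc i ≤? k) i≮k))

-- Through p₀ and one further atom all the N k look alike, up to flip.
N-align-p₀ : ∀ k k' b → Matches (perm b) (Nval k) (Nval k') 0
N-align-p₀ k k' false x = ⇔-refl
N-align-p₀ k k' true  x = flip-shift

align-points : ∀ s t → Σ Bool λ b → ∀ x → (perm b x ≡ point s) ⇔ (x ≡ point t)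
align-points true  true  = false , λ x → ⇔-refl
align-points false false = false , λ x → ⇔-refl
align-points true  false = true  , λ x → flip-shift
align-points false true  = true  , λ x → flip-shift

N-align : ∀ k k' p → Σ Bool λ b → Matches (perm b) (Nval k) (Nval k') p
N-align k k' zero    = false , N-align-p₀ k k' false
N-align k k' (suc i) = align-points (does (i ≤? k)) (does (i ≤? k'))

-- ∀(p₀, ‾∀p_{i+1}): if p₀ has a point a, then p_{i+1} ⊈ {a}
occupied : ℕ → Formula
occupied i = univ (pos 0) (nall (suc i))

-- ∀(p_{i+1}, ∀p_{i+2}): every point of p_{i+1} is the only point of p_{i+2}
linked : ℕ → Formula
linked i = univ (pos (suc i)) (uall (suc (suc i)))

separated : ℕ → Formula
separated n = univ (pos 1) (neg (suc n))

p₀-empty : Formula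
p₀-empty = univ (pos 0) (neg 0)

data Θ (n : ℕ) : Formula → Set where
  θ-occupied  : ∀ i → i ≤ n → Θ n (occupied i)
  θ-linked    : ∀ i → i < n → Θ n (linked i)
  θ-separated : Θ n (separated n)

Θ-H : ∀ {n} → AllH (Θ n)
Θ-H _ (θ-occupied i _) = univ-pc 0 _
Θ-H _ (θ-linked i _)   = univ-pc (suc i) _
Θ-H _ θ-separated      = univ-pc 1 _

-- Θ n forces p₀ to be empty: a point of p₀ makes each p_{i+1} (i ≤ n) inhabited,
-- the links put a point b of p₁ into all of them, contradicting separation.
Θ⊨p₀-empty : ExcludedMiddle 0ℓ → ∀ n → Θ n ⊨ p₀-empty
Θ⊨p₀-empty lem n M M⊨Θ a a∈p₀ _ = M⊨Θ _ θ-separated b b∈p₁ (chain n ℕP.≤-refl)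
  where
  open Structure M

  witness : ∀ i → i ≤ n → Σ Dom (val (suc i))
  witness i i≤n = decidable-stable lem λ empty →
    M⊨Θ _ (θ-occupied i i≤n) a a∈p₀ (λ b b∈ → ⊥-elim (empty (b , b∈)))

  b : Dom
  b = proj₁ (witness 0 z≤n)

  b∈p₁ : val 1 b
  b∈p₁ = proj₂ (witness 0 z≤n)

  chain : ∀ i → i ≤ n → val (suc i) b
  chain zero    _     = b∈p₁
  chain (suc i) i<n with witness (suc i) i<n
  ... | c , c∈ = subst (val (suc (suc i))) (sym (M⊨Θ _ (θ-linked i i<n) b (chain i (ℕP.<⇒≤ i<n)) c c∈)) c∈

N-occupied : ∀ {k} i → Sat (N k) (occupied i)
N-occupied i a refl u = base≢point _ (u _ refl)
  where
  base≢point : ∀ s → base ≢ point s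
  base≢point true  ()
  base≢point false ()

N-linked : ∀ {k i} → i ≢ k → Sat (N k) (linked i)
N-linked i≢k a refl b refl = cong point (side-step i≢k)

N-separated : ∀ {k n} → k < n → Sat (N k) (separated n)
N-separated {k} {n} k<n a refl a∈ = left≢right (trans a∈ (cong point (dec-false (n ≤? k) (ℕP.<⇒≱ k<n))))
  where
  left≢right : left ≢ right
  left≢right ()

N-refutes : ∀ {k} → ¬ Sat (N k) p₀-empty
N-refutes s = s base refl refl

p₀-transfer : ∀ {k k'} ψ → atomL ψ ≡ 0 ⊎ atomR ψ ≡ 0 → Sat (N k) ψ → Sat (N k') ψ
p₀-transfer {k} {k'} ψ (inj₁ l≡0) with N-align k k' (atomR ψ)
... | b , match = sat-transport (perm-involutive b) ψ
  (subst (Matches (perm b) (Nval k) (Nval k')) (sym l≡0) (N-align-p₀ k k' b)) match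
p₀-transfer {k} {k'} ψ (inj₂ r≡0) with N-align k k' (atomL ψ)
... | b , match = sat-transport (perm-involutive b) ψ match
  (subst (Matches (perm b) (Nval k) (Nval k')) (sym r≡0) (N-align-p₀ k k' b))

-- A consequence of Θ n not involving p₀ holds in each N k whose missing link it
-- avoids: N k restricted to the atoms of ψ still satisfies Θ n, since there p₀
-- and p_{k+1} become empty, and it agrees with N k on ψ.
consequence-holds : ∀ {n k} ψ → k < n → atomL ψ ≢ 0 → atomR ψ ≢ 0 → Avoids k ψ →
                    Θ n ⊨ ψ → Sat (N k) ψ
consequence-holds {n} {k} ψ k<n l≢0 r≢0 (avoid-l , avoid-r) entailed =
  sat-transport (λ _ → refl) ψ (λ x → mk⇔ proj₂ (inj₁ refl ,_)) (λ x → mk⇔ proj₂ (inj₂ refl ,_))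
    (entailed ⟪ restricted ⟫ restricted⊨Θ)
  where
  restricted : Valuation
  restricted p x = (p ≡ atomL ψ ⊎ p ≡ atomR ψ) × Nval k p x

  restricted⊨Θ : ∀ φ → Θ n φ → Sat ⟪ restricted ⟫ φ
  restricted⊨Θ _ (θ-occupied i _) a (inj₁ e , _) = ⊥-elim (l≢0 (sym e))
  restricted⊨Θ _ (θ-occupied i _) a (inj₂ e , _) = ⊥-elim (r≢0 (sym e))
  restricted⊨Θ _ (θ-linked i _) a (a-at , a∈) b (_ , b∈) with i ℕP.≟ k
  ... | no  i≢k  = N-linked i≢k a a∈ b b∈
  ... | yes refl = ⊥-elim ([ avoid-l ∘ sym , avoid-r ∘ sym ] a-at)
  restricted⊨Θ _ θ-separated a (_ , a∈p₁) (_ , a∈p) = N-separated k<n a a∈p₁ a∈p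

transfer : ∀ {n k k'} ψ → k' < n → Avoids k' ψ → Θ n ⊨ ψ → Sat (N k) ψ → Sat (N k') ψ
transfer ψ k'<n avoid entailed s with atomL ψ ℕP.≟ 0 | atomR ψ ℕP.≟ 0
... | yes l≡0 | _       = p₀-transfer ψ (inj₁ l≡0) s
... | no  _   | yes r≡0 = p₀-transfer ψ (inj₂ r≡0) s
... | no  l≢0 | no  r≢0 = consequence-holds ψ k'<n l≢0 r≢0 avoid entailed

module Invariance (lem : ExcludedMiddle 0ℓ) (X : List Rule) (sound : Sound X) where
  open Derivations X

  width : ℕ
  width = max 0 (map (length ∘ prem) X)

  width-bound : ∀ {r} → r ∈ X → length (prem r) ≤ width
  width-bound r∈X = All.lookup (xs≤max 0 _) (∈-map⁺ (length ∘ prem) r∈X)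

  -- more indices than there are atoms in the premises of any rule instance
  n : ℕ
  n = suc (width + width)

  Invariant : Formula → Set₁
  Invariant φ = Θ n ⊨ φ × (∀ {k} → k < n → Avoids k φ → Sat (N k) φ)

  invariant-≈ : ∀ {φ ψ} → φ ≈ ψ → Invariant ψ → Invariant φ
  invariant-≈ φ≈ψ (entailed , holds) =
    (λ M M⊨Θ → sat-≈ lem M φ≈ψ (entailed M M⊨Θ)) ,
    (λ k<n avoid → sat-≈ lem (N _) φ≈ψ (holds k<n (avoids-≈ φ≈ψ avoid)))

  invariant-Θ : ∀ φ → Θ n φ → Invariant φ
  invariant-Θ φ φ∈Θ = (λ M M⊨Θ → M⊨Θ φ φ∈Θ) , holds φ∈Θ
    where
    holds : ∀ {φ k} → Θ n φ → k < n → Avoids k φ → Sat (N k) φ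
    holds (θ-occupied i _) _   _           = N-occupied i
    holds (θ-linked i _)   _   (avoid , _) = N-linked (avoid ∘ cong suc)
    holds θ-separated      k<n _           = N-separated k<n

  -- Choose N k avoiding all premise atoms: it satisfies the premises, hence the
  -- conclusion, and transfer spreads this to every admissible N k'.
  invariant-rule : ∀ {r} → r ∈ X → ∀ g → (∀ i → Invariant (substF g (lookup (prem r) i))) →
                   Invariant (substF g (concl r))
  invariant-rule {r} r∈X g premises-invariant = entailed , holds
    where
    instance-of : Fin (length (prem r)) → Formula
    instance-of i = substF g (lookup (prem r) i)

    entailed : Θ n ⊨ substF g (concl r)
    entailed M M⊨Θ = rule-valid sound r∈X M g (λ i → proj₁ (premises-invariant i) M M⊨Θ)

    holds : ∀ {k'} → k' < n → Avoids k' (substF g (concl r)) → Sat (N k') (substF g (concl r))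
    holds k'<n avoid with fresh-index (s≤s (ℕP.+-mono-≤ (width-bound r∈X) (width-bound r∈X)))
                                      (atomL ∘ instance-of) (atomR ∘ instance-of)
    ... | k , k<n , fresh = transfer _ k'<n avoid entailed
      (rule-valid sound r∈X (N k) g (λ i → proj₂ (premises-invariant i) k<n (fresh i)))

  derivable-invariant : ∀ {ψ} → X ⊢[ Θ n ] ψ → Invariant ψ
  derivable-invariant = derivation-induction Invariant invariant-≈ invariant-rule invariant-Θ

theorem4p1 : ExcludedMiddle 0ℓ → (X : List Rule) → ¬ (Sound X × Complete X)
theorem4p1 lem X (sound , complete) = N-refutes {0} (proj₂ p₀-empty-invariant (s≤s z≤n) ((λ ()) , (λ ())))
  where
  open Invariance lem X sound

  p₀-empty-derivable : X ⊢[ Θ n ] p₀-empty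
  p₀-empty-derivable = complete (Θ n) p₀-empty Θ-H (univ-pc 0 (neg 0)) (Θ⊨p₀-empty lem n)

  p₀-empty-invariant : Invariant p₀-empty
  p₀-empty-invariant = derivable-invariant p₀-empty-derivable
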